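{- Let $n\ge3$ and let $\mathbf w=[w_1,w_2,\dots]$ be an infinite sequence in $\{1,\dots,n\}$ with $w_{t+1}\ne w_t$ for all $t$, in which every index occurs infinitely often. Let ${}_0x\in\mathbb{Z}_{>0}^n$, ${}_0y\in\mathbb{Z}_{\ge0}^n$, and define ${}_{t+1}x=\mathcal M_{w_{t+1};0}({}_tx)$, ${}_{t+1}y=\mathcal M_{w_{t+1};0}({}_ty)$. Let ${}_tl_j={}_ty_j/{}_tx_j$ and let ${}_tL=[\min_j {}_tl_j,\ \max_j {}_tl_j]$. Then the intervals ${}_tL$ converge to a point: there is $q\in\mathbb{R}$ with $\min_j{}_tl_j\to q$ and $\max_j{}_tl_j\to q$ as $t\to\infty$.
   Context: For $k\ge 0$ and $i\in\{1,\dots,n\}$, $\mathcal M_{i;k}(z_1,\dots,z_n)$ is obtained from $(z_1,\dots,z_n)$ by replacing $z_i$ with $z_1+\cdots+\widehat{z_i}+\cdots+z_n+k$ (omitting $z_i$ from the sum) and keeping the other coordinates. -}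

module Defs where

open import Data.Nat using (ℕ; zero; suc; _+_)
open import Data.Fin using (Fin; _≟_)
open import Data.List using (tabulate)
open import Data.Nat.ListAction using (sum)
open import Data.Bool using (if_then_else_)
open import Relation.Nullary using (does)
open import Data.Integer using (+_)
open import Data.Rational using (ℚ; _/_; _⊓_; _⊔_; 0ℚ)

sumExcept : ∀ {n} → Fin n → (Fin n → ℕ) → ℕ
sumExcept i z = sum (tabulate (λ j → if does (j ≟ i) then 0 else z j))

mutation : ∀ {n} → Fin n → ℕ → (Fin n → ℕ) → (Fin n → ℕ)
mutation i k z j = if does (j ≟ i) then sumExcept i z + k else z j

-- Iterates: seq w z 0 = z,  seq w z (t+1) = M_{w t ; 0}(seq w z t).
-- Here w t plays the role of the paper's w_{t+1}.
iter : ∀ {n} → (ℕ → Fin n) → (Fin n → ℕ) → ℕ → (Fin n → ℕ)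
iter w z zero = z
iter w z (suc t) = mutation (w t) 0 (iter w z t)

-- ratio y x = y / x as a rational (x = 0 never occurs in the theorem: x stays positive).
ratio : ℕ → ℕ → ℚ
ratio y zero = 0ℚ
ratio y (suc k) = (+ y) / suc k

-- minimum / maximum of a family over Fin n (n ≥ 1; value 0 for n = 0, unused)
minF : ∀ {n} → (Fin n → ℚ) → ℚ
minF {zero} f = 0ℚ
minF {suc zero} f = f Fin.zero
  where import Data.Fin as Fin
minF {suc (suc n)} f = f Fin.zero ⊓ minF (λ j → f (Fin.suc j))
  where import Data.Fin as Fin

maxF : ∀ {n} → (Fin n → ℚ) → ℚ
maxF {zero} f = 0ℚ
maxF {suc zero} f = f Fin.zero
  where import Data.Fin as Fin
maxF {suc (suc n)} f = f Fin.zero ⊔ maxF (λ j → f (Fin.suc j))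
  where import Data.Fin as Fin

l : ∀ {n} → (ℕ → Fin n) → (Fin n → ℕ) → (Fin n → ℕ) → ℕ → Fin n → ℚ
l w x₀ y₀ t j = ratio (iter w y₀ t j) (iter w x₀ t j)

lmin lmax : ∀ {n} → (ℕ → Fin n) → (Fin n → ℕ) → (Fin n → ℕ) → ℕ → ℚ
lmin w x₀ y₀ t = minF (l w x₀ y₀ t)
lmax w x₀ y₀ t = maxF (l w x₀ y₀ t)

{-# OPTIONS --safe #-}

-- Mutations act linearly, so ℚ-linear combinations of the x- and y-orbits are again orbits,
-- and orbits stay nonnegative. Applied to b·x − y and y − a·x, whose coordinates are
-- xⱼ (b − lⱼ) and xⱼ (lⱼ − a), this shows that max l never increases and min l never
-- decreases.
--
-- For the contraction let b = max l at time T, let j be mutated at σ ≥ T and not again up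
-- to time M, and put V = b·x − y. With xⱼ and vⱼ the values right after σ, the orbit
-- xⱼ V − 2 vⱼ x is dominated by a fixed vector of total sum 0 which is nonnegative off j,
-- and this domination survives every mutation off j; hence the coordinate k mutated at M
-- gets b − lₖ ≤ 2 (b − lⱼ), and symmetrically lₖ − a ≤ 2 (lⱼ − a). Once every index has
-- been mutated since T, all ratios lie in [(a + lₖ)/2, (b + lₖ)/2], so the width
-- max l − min l has at least halved. Every index recurs, so the width halves again and
-- again and the nested intervals shrink to a point.

module Submission where

open import Defs

-- Inside this module _≤_ is the order on ℚ; the statement at the end uses the order on ℕ.
module MutationDynamics where
  open import Level using (0ℓ)
  open import Function.Base using (_∘_; _$_)
  open import Data.Empty using (⊥-elim)
  open import Data.Bool.Base using (true; false; if_then_else_)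
  open import Data.Product using (∃; _×_; _,_; proj₁; proj₂)
  open import Data.Sum.Base using (inj₁; inj₂)
  open import Relation.Nullary using (does; yes; no)
  open import Relation.Nullary.Decidable.Core using (dec⇒maybe)
  open import Relation.Binary.PropositionalEquality
  open import Data.Nat.Base as ℕ using (ℕ; zero; suc; z≤n; s≤s; _^_; _≤′_; ≤′-refl; ≤′-step)
  import Data.Nat.Properties as ℕ
  import Data.Nat.ListAction as ℕ
  import Data.Nat.Coprimality as Coprime
  open import Data.Integer.Base as ℤ using (-[1+_])
  import Data.Integer.Properties as ℤ
  open import Data.Fin.Base using (Fin; zero; suc)
  open import Data.Fin.Properties using (_≟_)
  open import Data.List.Base using (tabulate)
  open import Data.List.Extrema.Nat using (max; xs≤max; v≤max⁺)
  open import Data.List.Relation.Unary.All.Properties using (tabulate⁻)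
  open import Data.Rational.Base
  open import Data.Rational.Properties hiding (_≟_)
  import Data.Rational.Properties as ℚ using (_≟_)
  import Data.Rational.Unnormalised.Base as ℚᵘ
  import Data.Rational.Unnormalised.Properties as ℚᵘ
  open import Algebra.Bundles using (CommutativeRing)
  open import Algebra.Properties.Semiring.Sum (CommutativeRing.semiring +-*-commutativeRing)
    using (sum; ∑-distrib-+; *-distribˡ-sum; sum-cong-≗)
  open import Tactic.RingSolver using (solve-∀)
  open import Tactic.RingSolver.Core.AlmostCommutativeRing
    using (AlmostCommutativeRing; fromCommutativeRing)

  ℚ-ring : AlmostCommutativeRing 0ℓ 0ℓ
  ℚ-ring = fromCommutativeRing +-*-commutativeRing (λ p → dec⇒maybe (0ℚ ℚ.≟ p))

  fromℕ : ℕ → ℚ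
  fromℕ n = mkℚ (ℤ.+ n) 0 (Coprime.sym (Coprime.1-coprimeTo n))

  fromℕ-+ : ∀ m n → fromℕ (m ℕ.+ n) ≡ fromℕ m + fromℕ n
  fromℕ-+ m n = begin
    fromℕ (m ℕ.+ n)                            ≡⟨ ↥p/↧p≡p (fromℕ (m ℕ.+ n)) ⟨
    ℤ.+ (m ℕ.+ n) / 1                          ≡⟨ /-cong (ℤ.pos-+ m n) refl ⟩
    (ℤ.+ m ℤ.+ ℤ.+ n) / 1
      ≡⟨ /-cong (cong₂ ℤ._+_ (ℤ.*-identityʳ (ℤ.+ m)) (ℤ.*-identityʳ (ℤ.+ n))) refl ⟨
    (ℤ.+ m ℤ.* ℤ.+ 1 ℤ.+ ℤ.+ n ℤ.* ℤ.+ 1) / 1  ∎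
    where open ≡-Reasoning

  fromℕ-pos : ∀ {m} → 1 ℕ.≤ m → 0ℚ < fromℕ m
  fromℕ-pos {suc m} _ = positive⁻¹ (fromℕ (suc m))

  fromℕ-*-ratio : ∀ y x → 0ℚ < fromℕ x → fromℕ x * ratio y x ≡ fromℕ y
  fromℕ-*-ratio y zero    0<0 = ⊥-elim (<-irrefl refl 0<0)
  fromℕ-*-ratio y (suc k) _   = toℚᵘ-injective (begin-equality
    toℚᵘ (fromℕ (suc k) * ratio y (suc k))
      ≃⟨ toℚᵘ-homo-* (fromℕ (suc k)) (ratio y (suc k)) ⟩
    ℚᵘ.mkℚᵘ (ℤ.+ suc k) 0 ℚᵘ.* toℚᵘ (ratio y (suc k))
      ≃⟨ ℚᵘ.*-congˡ {ℚᵘ.mkℚᵘ (ℤ.+ suc k) 0} (toℚᵘ-fromℚᵘ (ℚᵘ.mkℚᵘ (ℤ.+ y) k)) ⟩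
    ℚᵘ.mkℚᵘ (ℤ.+ suc k) 0 ℚᵘ.* ℚᵘ.mkℚᵘ (ℤ.+ y) k
      ≃⟨ ℚᵘ.*≡* (cross (ℤ.+ suc k) (ℤ.+ y) (cong (λ d → ℤ.+ suc d) (ℕ.+-identityʳ k))) ⟩
    ℚᵘ.mkℚᵘ (ℤ.+ y) 0
      ∎)
    where
    open ℚᵘ.≤-Reasoning
    cross : ∀ d y {e} → e ≡ d → (d ℤ.* y) ℤ.* ℤ.+ 1 ≡ y ℤ.* e
    cross d y refl = trans (ℤ.*-identityʳ (d ℤ.* y)) (ℤ.*-comm d y)

  fromℕ-mono-≤ : ∀ {m n} → m ℕ.≤ n → fromℕ m ≤ fromℕ n
  fromℕ-mono-≤ m≤n = *≤* (ℤ.*-monoʳ-≤-nonNeg (ℤ.+ 1) (ℤ.+≤+ m≤n))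

  fromℕ-unbounded : ∀ p → ∃ λ N → p < fromℕ N
  fromℕ-unbounded (mkℚ i d-1 _) = suc ℤ.∣ i ∣ , *<* (bound i)
    where
    bound : ∀ i → i ℤ.* ℤ.+ 1 ℤ.< ℤ.+ suc ℤ.∣ i ∣ ℤ.* ℤ.+ suc d-1
    bound (ℤ.+ a)    = subst₂ ℤ._<_ (ℤ.pos-* a 1) (ℤ.pos-* (suc a) (suc d-1))
                       (ℤ.+<+ (subst (ℕ._< suc a ℕ.* suc d-1) (sym (ℕ.*-identityʳ a)) (ℕ.m≤m*n (suc a) (suc d-1))))
    bound -[1+ a ] = subst (-[1+ a ] ℤ.* ℤ.+ 1 ℤ.<_) (ℤ.pos-* (suc (suc a)) (suc d-1)) ℤ.-<+

  n≤2^n : ∀ n → n ℕ.≤ 2 ^ n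
  n≤2^n zero    = z≤n
  n≤2^n (suc n) = ℕ.+-mono-≤ (ℕ.m^n>0 2 n) (ℕ.≤-trans (n≤2^n n) (ℕ.m≤m+n (2 ^ n) 0))

  2^-archimedean : ∀ p ε → 0ℚ < ε → ∃ λ K → p < fromℕ (2 ^ K) * ε
  2^-archimedean p ε 0<ε = N , (begin-strict
    p                  ≡⟨ p≡p/ε*ε ⟨
    p * 1/ ε * ε       <⟨ *-monoˡ-<-pos ε p/ε<N ⟩
    fromℕ N * ε        ≤⟨ *-monoʳ-≤-nonNeg ε (fromℕ-mono-≤ (n≤2^n N)) ⟩
    fromℕ (2 ^ N) * ε  ∎)
    where
    open ≤-Reasoning
    instance
      ε-pos : Positive ε
      ε-pos = positive 0<ε
      ε-nonNeg : NonNegative ε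
      ε-nonNeg = pos⇒nonNeg ε
      ε-nonZero : NonZero ε
      ε-nonZero = pos⇒nonZero ε
    N : ℕ
    N = proj₁ (fromℕ-unbounded (p * 1/ ε))
    p/ε<N : p * 1/ ε < fromℕ N
    p/ε<N = proj₂ (fromℕ-unbounded (p * 1/ ε))
    p≡p/ε*ε : p * 1/ ε * ε ≡ p
    p≡p/ε*ε = trans (*-assoc p (1/ ε) ε) (trans (cong (p *_) (*-inverseˡ ε)) (*-identityʳ p))

  p≤p+q : ∀ {p q} → 0ℚ ≤ q → p ≤ p + q
  p≤p+q {p} 0≤q = subst (_≤ p + _) (+-identityʳ p) (+-monoʳ-≤ p 0≤q)

  p≤q+p : ∀ {p q} → 0ℚ ≤ q → p ≤ q + p
  p≤q+p {p} {q} 0≤q = subst (p ≤_) (+-comm p q) (p≤p+q 0≤q)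

  p+q≤p : ∀ {p q} → q ≤ 0ℚ → p + q ≤ p
  p+q≤p {p} {q} q≤0 = subst (p + q ≤_) (+-identityʳ p) (+-monoʳ-≤ p q≤0)

  0≤p*q : ∀ {p q} → 0ℚ ≤ p → 0ℚ ≤ q → 0ℚ ≤ p * q
  0≤p*q {p} {q} 0≤p 0≤q =
    nonNegative⁻¹ (p * q) {{nonNeg*nonNeg⇒nonNeg p {{nonNegative 0≤p}} q {{nonNegative 0≤q}}}}

  _∈[_,_] : ℚ → ℚ → ℚ → Set
  p ∈[ a , b ] = a ≤ p × p ≤ b

  ∣p-q∣≤b-a : ∀ {a b p q} → p ∈[ a , b ] → q ∈[ a , b ] → ∣ p - q ∣ ≤ b - a
  ∣p-q∣≤b-a {a} {b} {p} {q} (a≤p , p≤b) (a≤q , q≤b) with ∣p∣≡p∨∣p∣≡-p (p - q)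
  ... | inj₁ ∣p-q∣≡p-q  = subst (_≤ b - a) (sym ∣p-q∣≡p-q) (+-mono-≤ p≤b (neg-antimono-≤ a≤q))
  ... | inj₂ ∣p-q∣≡q-p =
    subst (_≤ b - a) (sym (trans ∣p-q∣≡q-p (flip p q))) (+-mono-≤ q≤b (neg-antimono-≤ a≤p))
    where
    flip : ∀ p q → - (p - q) ≡ q - p
    flip = solve-∀ ℚ-ring

  q≤p⇒0≤p-q : ∀ {p q} → q ≤ p → 0ℚ ≤ p - q
  q≤p⇒0≤p-q {p} {q} q≤p = subst (_≤ p - q) (+-inverseʳ q) (+-monoˡ-≤ (- q) q≤p)

  0≤p-q⇒q≤p : ∀ {p q} → 0ℚ ≤ p - q → q ≤ p
  0≤p-q⇒q≤p {p} {q} 0≤p-q = subst₂ _≤_ (+-identityˡ q) (cancel p q) (+-monoˡ-≤ q 0≤p-q)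
    where
    cancel : ∀ p q → p - q + q ≡ p
    cancel = solve-∀ ℚ-ring

  maxF-ub : ∀ {n} (f : Fin n → ℚ) j → f j ≤ maxF f
  maxF-ub {suc zero}    f zero    = ≤-refl
  maxF-ub {suc (suc n)} f zero    = p≤p⊔q (f zero) (maxF (f ∘ suc))
  maxF-ub {suc (suc n)} f (suc j) = ≤-trans (maxF-ub (f ∘ suc) j) (p≤q⊔p (f zero) (maxF (f ∘ suc)))

  minF-lb : ∀ {n} (f : Fin n → ℚ) j → minF f ≤ f j
  minF-lb {suc zero}    f zero    = ≤-refl
  minF-lb {suc (suc n)} f zero    = p⊓q≤p (f zero) (minF (f ∘ suc))
  minF-lb {suc (suc n)} f (suc j) = ≤-trans (p⊓q≤q (f zero) (minF (f ∘ suc))) (minF-lb (f ∘ suc) j)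

  maxF-attained : ∀ {n} (f : Fin (suc n) → ℚ) → ∃ λ j → maxF f ≡ f j
  maxF-attained {zero}  f = zero , refl
  maxF-attained {suc n} f with ⊔-sel (f zero) (maxF (f ∘ suc))
  ... | inj₁ max≡f₀ = zero , max≡f₀
  ... | inj₂ max≡rest with maxF-attained (f ∘ suc)
  ...   | j , rest≡fⱼ = suc j , trans max≡rest rest≡fⱼ

  minF-attained : ∀ {n} (f : Fin (suc n) → ℚ) → ∃ λ j → minF f ≡ f j
  minF-attained {zero}  f = zero , refl
  minF-attained {suc n} f with ⊓-sel (f zero) (minF (f ∘ suc))
  ... | inj₁ min≡f₀ = zero , min≡f₀
  ... | inj₂ min≡rest with minF-attained (f ∘ suc)
  ...   | j , rest≡fⱼ = suc j , trans min≡rest rest≡fⱼ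

  -- The summands of sumExcept i z and mutation i k z itself are instances of replace.
  replace : ∀ {A : Set} {n} → Fin n → A → (Fin n → A) → Fin n → A
  replace i a f j = if does (j ≟ i) then a else f j

  module _ {A : Set} {n} {i : Fin n} {a : A} {f : Fin n → A} where

    replace-same : replace i a f i ≡ a
    replace-same with i ≟ i
    ... | yes _  = refl
    ... | no i≢i = ⊥-elim (i≢i refl)

    replace-other : ∀ {j} → j ≢ i → replace i a f j ≡ f j
    replace-other {j} j≢i with j ≟ i
    ... | yes j≡i = ⊥-elim (j≢i j≡i)
    ... | no _    = refl

    replace-pointwise : (P : Fin n → A → Set) → P i a → (∀ j → P j (f j)) → ∀ j → P j (replace i a f j)
    replace-pointwise P Pa Pf j with j ≟ i
    ... | yes refl = Pa
    ... | no _     = Pf j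

  sumExceptℚ : ∀ {n} → Fin n → (Fin n → ℚ) → ℚ
  sumExceptℚ i f = sum (replace i 0ℚ f)

  sum-replace : ∀ {n} (i : Fin n) a f → sum (replace i a f) ≡ sumExceptℚ i f + a
  sum-replace zero    a f = trans (+-comm a (sum (f ∘ suc))) (cong (_+ a) (sym (+-identityˡ (sum (f ∘ suc)))))
  sum-replace (suc i) a f =
    trans (cong (f zero +_) (sum-replace i a (f ∘ suc))) (sym (+-assoc (f zero) _ a))

  sum-split : ∀ {n} (i : Fin n) f → sum f ≡ sumExceptℚ i f + f i
  sum-split i f = trans (sum-cong-≗ replace-id) (sum-replace i (f i) f)
    where
    replace-id : ∀ j → f j ≡ replace i (f i) f j
    replace-id j with j ≟ i
    ... | yes refl = refl
    ... | no _     = refl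

  sum-mono : ∀ {n} {f g : Fin n → ℚ} → (∀ j → f j ≤ g j) → sum f ≤ sum g
  sum-mono {zero}  f≤g = ≤-refl
  sum-mono {suc n} f≤g = +-mono-≤ (f≤g zero) (sum-mono (f≤g ∘ suc))

  sum-nonneg : ∀ {n} {f : Fin n → ℚ} → (∀ j → 0ℚ ≤ f j) → 0ℚ ≤ sum f
  sum-nonneg {zero}  0≤f = ≤-refl
  sum-nonneg {suc n} 0≤f = +-mono-≤ (0≤f zero) (sum-nonneg (0≤f ∘ suc))

  module _ {n} (i : Fin n) where

    sumExcept-mono : ∀ {f g} → (∀ j → j ≢ i → f j ≤ g j) → sumExceptℚ i f ≤ sumExceptℚ i g
    sumExcept-mono {f} {g} f≤g = sum-mono replaced≤
      where
      replaced≤ : ∀ j → replace i 0ℚ f j ≤ replace i 0ℚ g j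
      replaced≤ j with j ≟ i
      ... | yes _   = ≤-refl
      ... | no j≢i  = f≤g j j≢i

    sumExcept-nonneg : ∀ {f} → (∀ j → 0ℚ ≤ f j) → 0ℚ ≤ sumExceptℚ i f
    sumExcept-nonneg 0≤f = sum-nonneg (replace-pointwise (λ _ q → 0ℚ ≤ q) ≤-refl 0≤f)

    sumExcept-nonpos : ∀ {f u} → sum u ≤ 0ℚ → 0ℚ ≤ u i → (∀ j → f j ≤ u j) → sumExceptℚ i f ≤ 0ℚ
    sumExcept-nonpos {f} {u} ∑u≤0 0≤uᵢ f≤u = begin
      sumExceptℚ i f        ≤⟨ sumExcept-mono (λ j _ → f≤u j) ⟩
      sumExceptℚ i u        ≤⟨ p≤p+q 0≤uᵢ ⟩
      sumExceptℚ i u + u i  ≡⟨ sum-split i u ⟨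
      sum u                 ≤⟨ ∑u≤0 ⟩
      0ℚ                    ∎
      where open ≤-Reasoning

    sumExcept-linear : ∀ {α β} {f g h} → (∀ j → h j ≡ α * f j + β * g j) →
                       sumExceptℚ i h ≡ α * sumExceptℚ i f + β * sumExceptℚ i g
    sumExcept-linear {α} {β} {f} {g} {h} h≡ = begin
      sum (replace i 0ℚ h)                                        ≡⟨ sum-cong-≗ replaced≡ ⟩
      sum (λ j → α * replace i 0ℚ f j + β * replace i 0ℚ g j)
        ≡⟨ ∑-distrib-+ (λ j → α * replace i 0ℚ f j) (λ j → β * replace i 0ℚ g j) ⟩
      sum (λ j → α * replace i 0ℚ f j) + sum (λ j → β * replace i 0ℚ g j)
        ≡⟨ cong₂ _+_ (*-distribˡ-sum α (replace i 0ℚ f)) (*-distribˡ-sum β (replace i 0ℚ g)) ⟨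
      α * sumExceptℚ i f + β * sumExceptℚ i g                     ∎
      where
      open ≡-Reasoning
      replaced≡ : ∀ j → replace i 0ℚ h j ≡ α * replace i 0ℚ f j + β * replace i 0ℚ g j
      replaced≡ j with does (j ≟ i)
      ... | true  = sym (trans (cong₂ _+_ (*-zeroʳ α) (*-zeroʳ β)) (+-identityʳ 0ℚ))
      ... | false = h≡ j

  ≤-sumExcept : ∀ {n} (i : Fin n) {f j} → (∀ j → 0ℚ ≤ f j) → j ≢ i → f j ≤ sumExceptℚ i f
  ≤-sumExcept i {f} {j} 0≤f j≢i = begin
    f j                                              ≤⟨ p≤q+p (sumExcept-nonneg j 0≤f') ⟩
    sumExceptℚ j (replace i 0ℚ f) + f j
      ≡⟨ cong (sumExceptℚ j (replace i 0ℚ f) +_) (replace-other {a = 0ℚ} {f = f} j≢i) ⟨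
    sumExceptℚ j (replace i 0ℚ f) + replace i 0ℚ f j ≡⟨ sum-split j (replace i 0ℚ f) ⟨
    sumExceptℚ i f                                   ∎
    where
    open ≤-Reasoning
    0≤f' : ∀ k → 0ℚ ≤ replace i 0ℚ f k
    0≤f' = replace-pointwise (λ _ q → 0ℚ ≤ q) ≤-refl 0≤f

  fromℕ-sumExcept : ∀ {n} (i : Fin n) z → fromℕ (sumExcept i z) ≡ sumExceptℚ i (fromℕ ∘ z)
  fromℕ-sumExcept i z = trans (fromℕ-sum (replace i 0 z)) (sum-cong-≗ replaced≡)
    where
    fromℕ-sum : ∀ {n} (g : Fin n → ℕ) → fromℕ (ℕ.sum (tabulate g)) ≡ sum (fromℕ ∘ g)
    fromℕ-sum {zero}  g = refl
    fromℕ-sum {suc n} g = trans (fromℕ-+ (g zero) _) (cong (fromℕ (g zero) +_) (fromℕ-sum (g ∘ suc)))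
    replaced≡ : ∀ j → fromℕ (replace i 0 z j) ≡ replace i 0ℚ (fromℕ ∘ z) j
    replaced≡ j with does (j ≟ i)
    ... | true  = refl
    ... | false = refl

  mutationℚ : ∀ {n} → Fin n → (Fin n → ℚ) → Fin n → ℚ
  mutationℚ i f = replace i (sumExceptℚ i f) f

  fromℕ-mutation : ∀ {n} (i : Fin n) z j → fromℕ (mutation i 0 z j) ≡ mutationℚ i (fromℕ ∘ z) j
  fromℕ-mutation i z j with does (j ≟ i)
  ... | true  = trans (cong fromℕ (ℕ.+-identityʳ (sumExcept i z))) (fromℕ-sumExcept i z)
  ... | false = refl

  mutation-linear : ∀ {n} (i : Fin n) {α β} {f g h} → (∀ j → h j ≡ α * f j + β * g j) →
                    ∀ j → mutationℚ i h j ≡ α * mutationℚ i f j + β * mutationℚ i g j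
  mutation-linear i {α} {β} {f} {g} h≡ j with does (j ≟ i)
  ... | true  = sumExcept-linear i {α} {β} {f} {g} h≡
  ... | false = h≡ j

  interval-induction : ∀ (P : ℕ → Set) {s u} → (∀ {t} → s ℕ.≤ t → t ℕ.< u → P t → P (suc t)) →
                       s ℕ.≤ u → P s → P u
  interval-induction P {s} {u} step s≤u Ps = go (ℕ.≤⇒≤′ s≤u) ℕ.≤-refl
    where
    go : ∀ {t} → s ≤′ t → t ℕ.≤ u → P t
    go ≤′-refl         _   = Ps
    go (≤′-step s≤′t) t<u = step (ℕ.≤′⇒≤ s≤′t) t<u (go s≤′t (ℕ.<⇒≤ t<u))

  module Orbits {n} (w : ℕ → Fin n) where

    Orbit : (ℕ → Fin n → ℚ) → Set
    Orbit F = ∀ t → F (suc t) ≗ mutationℚ (w t) (F t)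

    Untouched : Fin n → ℕ → ℕ → Set
    Untouched j s u = ∀ r → s ℕ.≤ r → r ℕ.< u → w r ≢ j

    untouched-empty : ∀ {j s} → Untouched j s s
    untouched-empty r s≤r r<s = ⊥-elim (ℕ.<⇒≱ r<s s≤r)

    untouched-shrink : ∀ {j s u} → Untouched j s (suc u) → Untouched j s u
    untouched-shrink untouched r s≤r r<u = untouched r s≤r (ℕ.m≤n⇒m≤1+n r<u)

    untouched-extend : ∀ {j s u} → Untouched j s u → w u ≢ j → Untouched j s (suc u)
    untouched-extend untouched wu≢j r s≤r r<u+1 with ℕ.m≤n⇒m<n∨m≡n (ℕ.≤-pred r<u+1)
    ... | inj₁ r<u  = untouched r s≤r r<u
    ... | inj₂ refl = wu≢j

    iter-orbit : ∀ z → Orbit (λ t j → fromℕ (iter w z t j))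
    iter-orbit z t = fromℕ-mutation (w t) (iter w z t)

    orbit-linear : ∀ {F G H α β} → Orbit F → Orbit G → (∀ t j → H t j ≡ α * F t j + β * G t j) → Orbit H
    orbit-linear {F} {G} {H} {α} {β} F-orbit G-orbit H≡ t j = begin
      H (suc t) j                                                ≡⟨ H≡ (suc t) j ⟩
      α * F (suc t) j + β * G (suc t) j
        ≡⟨ cong₂ (λ p q → α * p + β * q) (F-orbit t j) (G-orbit t j) ⟩
      α * mutationℚ (w t) (F t) j + β * mutationℚ (w t) (G t) j
        ≡⟨ mutation-linear (w t) {α} {β} {F t} {G t} (H≡ t) j ⟨
      mutationℚ (w t) (H t) j                                    ∎
      where open ≡-Reasoning

    module _ {F} (F-orbit : Orbit F) where

      orbit-at : ∀ t → F (suc t) (w t) ≡ sumExceptℚ (w t) (F t)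
      orbit-at t = trans (F-orbit t (w t)) (replace-same {f = F t})

      orbit-off : ∀ {t j} → w t ≢ j → F (suc t) j ≡ F t j
      orbit-off {t} {j} w≢j = trans (F-orbit t j) (replace-other {f = F t} (w≢j ∘ sym))

      orbit-replace-sum : ∀ σ → sum (replace (w σ) (- F (suc σ) (w σ)) (F σ)) ≡ 0ℚ
      orbit-replace-sum σ = begin
        sum (replace (w σ) (- F (suc σ) (w σ)) (F σ))  ≡⟨ sum-replace (w σ) (- F (suc σ) (w σ)) (F σ) ⟩
        sumExceptℚ (w σ) (F σ) - F (suc σ) (w σ)       ≡⟨ cong (_- F (suc σ) (w σ)) (orbit-at σ) ⟨
        F (suc σ) (w σ) - F (suc σ) (w σ)              ≡⟨ +-inverseʳ (F (suc σ) (w σ)) ⟩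
        0ℚ                                             ∎
        where open ≡-Reasoning

      orbit-pointwise : ∀ (P : Fin n → ℚ → Set) {t} → P (w t) (sumExceptℚ (w t) (F t)) →
                        (∀ j → P j (F t j)) → ∀ j → P j (F (suc t) j)
      orbit-pointwise P {t} Pat Pt j = subst (P j) (sym (F-orbit t j)) (replace-pointwise P Pat Pt j)

      orbit-nonneg : ∀ {s u} → s ℕ.≤ u → (∀ j → 0ℚ ≤ F s j) → ∀ j → 0ℚ ≤ F u j
      orbit-nonneg = interval-induction (λ t → ∀ j → 0ℚ ≤ F t j)
        (λ {t} _ _ 0≤Ft → orbit-pointwise (λ _ q → 0ℚ ≤ q) (sumExcept-nonneg (w t) 0≤Ft) 0≤Ft)

      orbit-frozen : ∀ {j s u} → s ℕ.≤ u → Untouched j s u → F u j ≡ F s j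
      orbit-frozen {j} {s} s≤u untouched = interval-induction (λ t → F t j ≡ F s j)
        (λ {t} s≤t t<u Ft≡Fs → trans (orbit-off (untouched t s≤t t<u)) Ft≡Fs) s≤u refl

      module _ {u : Fin n → ℚ} {j : Fin n} (∑u≤0 : sum u ≤ 0ℚ) (0≤u : ∀ k → k ≢ j → 0ℚ ≤ u k) where

        orbit-bounded : ∀ {s v} → s ℕ.≤ v → Untouched j s v → (∀ k → F s k ≤ u k) → ∀ k → F v k ≤ u k
        orbit-bounded {s} {v} s≤v untouched = interval-induction (λ t → ∀ k → F t k ≤ u k) step s≤v
          where
          step : ∀ {t} → s ℕ.≤ t → t ℕ.< v → (∀ k → F t k ≤ u k) → ∀ k → F (suc t) k ≤ u k
          step {t} s≤t t<v Ft≤u = orbit-pointwise (λ k q → q ≤ u k)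
            (≤-trans (sumExcept-nonpos (w t) ∑u≤0 0≤uₜ Ft≤u) 0≤uₜ) Ft≤u
            where
            0≤uₜ : 0ℚ ≤ u (w t)
            0≤uₜ = 0≤u (w t) (untouched t s≤t t<v)

        orbit-mutated-nonpos : ∀ {s M} → s ℕ.≤ M → Untouched j s (suc M) → (∀ k → F s k ≤ u k) →
                               F (suc M) (w M) ≤ 0ℚ
        orbit-mutated-nonpos {s} {M} s≤M untouched Fs≤u = subst (_≤ 0ℚ) (sym (orbit-at M))
          (sumExcept-nonpos (w M) ∑u≤0 (0≤u (w M) (untouched M s≤M ℕ.≤-refl))
            (orbit-bounded s≤M (untouched-shrink untouched) Fs≤u))

    module AfterMutation {X V σ} (X-orbit : Orbit X) (V-orbit : Orbit V)
                         (0≤Xσ : ∀ k → 0ℚ ≤ X σ k) (0≤Vσ : ∀ k → 0ℚ ≤ V σ k) where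

      j : Fin n
      j = w σ

      xⱼ vⱼ : ℚ
      xⱼ = X (suc σ) j
      vⱼ = V (suc σ) j

      G : ℕ → Fin n → ℚ
      G t k = xⱼ * V t k + - (vⱼ + vⱼ) * X t k

      u : Fin n → ℚ
      u k = xⱼ * replace j (- vⱼ) (V σ) k

      0≤X : ∀ k → 0ℚ ≤ X (suc σ) k
      0≤X = orbit-nonneg X-orbit (ℕ.n≤1+n σ) 0≤Xσ

      sum-u : sum u ≡ 0ℚ
      sum-u = trans (sym (*-distribˡ-sum xⱼ (replace j (- vⱼ) (V σ))))
                (trans (cong (xⱼ *_) (orbit-replace-sum V-orbit σ)) (*-zeroʳ xⱼ))

      0≤u : ∀ k → k ≢ j → 0ℚ ≤ u k
      0≤u k k≢j = subst (λ q → 0ℚ ≤ xⱼ * q) (sym (replace-other {f = V σ} k≢j)) (0≤p*q (0≤X j) (0≤Vσ k))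

      G≤u : ∀ k → G (suc σ) k ≤ u k
      G≤u k with k ≟ j
      ... | yes refl = ≤-reflexive (at-j xⱼ vⱼ)
        where
        at-j : ∀ x v → x * v + - (v + v) * x ≡ x * - v
        at-j = solve-∀ ℚ-ring
      ... | no k≢j = begin
        xⱼ * V (suc σ) k + - (vⱼ + vⱼ) * X (suc σ) k  ≤⟨ p+q≤p -2vⱼxₖ≤0 ⟩
        xⱼ * V (suc σ) k                              ≡⟨ cong (xⱼ *_) (orbit-off V-orbit (k≢j ∘ sym)) ⟩
        xⱼ * V σ k                                    ∎
        where
        open ≤-Reasoning
        0≤vⱼ : 0ℚ ≤ vⱼ
        0≤vⱼ = orbit-nonneg V-orbit (ℕ.n≤1+n σ) 0≤Vσ j
        -2vⱼxₖ≤0 : - (vⱼ + vⱼ) * X (suc σ) k ≤ 0ℚ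
        -2vⱼxₖ≤0 = subst (_≤ 0ℚ) (neg-distribˡ-* (vⱼ + vⱼ) (X (suc σ) k))
                     (neg-antimono-≤ (0≤p*q (+-mono-≤ 0≤vⱼ 0≤vⱼ) (0≤X k)))

      orbit-halving : ∀ {M} → σ ℕ.< M → Untouched j (suc σ) (suc M) →
                      X (suc M) j * V (suc M) (w M) ≤ (V (suc M) j + V (suc M) j) * X (suc M) (w M)
      orbit-halving {M} σ<M untouched = begin
        X (suc M) j * V (suc M) (w M)
          ≡⟨ cong (_* V (suc M) (w M)) (orbit-frozen X-orbit σ<M+1 untouched) ⟩
        xⱼ * V (suc M) (w M)                           ≡⟨ split xⱼ vⱼ (V (suc M) (w M)) (X (suc M) (w M)) ⟩
        G (suc M) (w M) + (vⱼ + vⱼ) * X (suc M) (w M)  ≤⟨ +-monoˡ-≤ _ G≤0 ⟩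
        0ℚ + (vⱼ + vⱼ) * X (suc M) (w M)               ≡⟨ +-identityˡ _ ⟩
        (vⱼ + vⱼ) * X (suc M) (w M)
          ≡⟨ cong (λ v → (v + v) * X (suc M) (w M)) (orbit-frozen V-orbit σ<M+1 untouched) ⟨
        (V (suc M) j + V (suc M) j) * X (suc M) (w M)  ∎
        where
        open ≤-Reasoning
        σ<M+1 : suc σ ℕ.≤ suc M
        σ<M+1 = ℕ.m≤n⇒m≤1+n σ<M
        split : ∀ x v p q → x * p ≡ (x * p + - (v + v) * q) + (v + v) * q
        split = solve-∀ ℚ-ring
        G≤0 : G (suc M) (w M) ≤ 0ℚ
        G≤0 = orbit-mutated-nonpos (orbit-linear {α = xⱼ} {β = - (vⱼ + vⱼ)} V-orbit X-orbit (λ _ _ → refl))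
                (≤-reflexive sum-u) 0≤u σ<M untouched G≤u

    module Weighting {X} (X-orbit : Orbit X) (X-pos : ∀ t j → 0ℚ < X t j) where

      record Weighted (D : ℕ → Fin n → ℚ) : Set where
        constructor weighted
        field orbit : Orbit (λ t j → X t j * D t j)

      weighted-nonneg : ∀ {D s u} → Weighted D → s ℕ.≤ u → (∀ j → 0ℚ ≤ D s j) → ∀ j → 0ℚ ≤ D u j
      weighted-nonneg {D} {s} {u} (weighted XD-orbit) s≤u 0≤Ds j = *-cancelˡ-≤-pos (X u j) {{positive (X-pos u j)}}
        (subst (_≤ X u j * D u j) (sym (*-zeroʳ (X u j)))
          (orbit-nonneg XD-orbit s≤u (λ k → 0≤p*q (<⇒≤ (X-pos s k)) (0≤Ds k)) j))

      weighted-halving : ∀ {D σ M} → Weighted D → (∀ j → 0ℚ ≤ D σ j) →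
                         σ ℕ.< M → Untouched (w σ) (suc σ) (suc M) →
                         D (suc M) (w M) ≤ D (suc M) (w σ) + D (suc M) (w σ)
      weighted-halving {D} {σ} {M} (weighted XD-orbit) 0≤Dσ σ<M untouched =
        *-cancelˡ-≤-pos (xⱼ * x) {{pos*pos⇒pos xⱼ {{positive (X-pos _ _)}} x {{positive (X-pos _ _)}}}}
          (subst₂ _≤_ (regroupˡ xⱼ x d) (regroupʳ xⱼ x dⱼ)
            (AfterMutation.orbit-halving X-orbit XD-orbit
               (λ k → <⇒≤ (X-pos σ k)) (λ k → 0≤p*q (<⇒≤ (X-pos σ k)) (0≤Dσ k)) σ<M untouched))
        where
        xⱼ x dⱼ d : ℚ
        xⱼ = X (suc M) (w σ)
        x  = X (suc M) (w M)
        dⱼ = D (suc M) (w σ)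
        d  = D (suc M) (w M)
        regroupˡ : ∀ xⱼ x d → xⱼ * (x * d) ≡ (xⱼ * x) * d
        regroupˡ = solve-∀ ℚ-ring
        regroupʳ : ∀ xⱼ x dⱼ → (xⱼ * dⱼ + xⱼ * dⱼ) * x ≡ (xⱼ * x) * (dⱼ + dⱼ)
        regroupʳ = solve-∀ ℚ-ring

    last-mutation : ∀ {j t M} → t ℕ.< M → w t ≡ j →
                    ∃ λ σ → t ℕ.≤ σ × σ ℕ.< M × w σ ≡ j × Untouched j (suc σ) M
    last-mutation {j} {t} {suc M} (s≤s t≤M) wt≡j with w M ≟ j
    ... | yes wM≡j = M , t≤M , ℕ.≤-refl , wM≡j , untouched-empty
    ... | no wM≢j with ℕ.m≤n⇒m<n∨m≡n t≤M
    ...   | inj₂ refl = ⊥-elim (wM≢j wt≡j)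
    ...   | inj₁ t<M with last-mutation t<M wt≡j
    ...     | σ , t≤σ , σ<M , wσ≡j , untouched =
                σ , t≤σ , ℕ.m≤n⇒m≤1+n σ<M , wσ≡j , untouched-extend untouched wM≢j

    Recurrent : Set
    Recurrent = ∀ i t → ∃ λ s → t ℕ.≤ s × w s ≡ i

    LastMutatedBetween : ℕ → ℕ → Fin n → Set
    LastMutatedBetween T M j = ∃ λ σ → T ℕ.≤ σ × σ ℕ.< M × w σ ≡ j × Untouched j (suc σ) (suc M)

    all-mutated-between : Recurrent → ∀ T → ∃ λ M → T ℕ.≤ M × (∀ j → j ≢ w M → LastMutatedBetween T M j)
    all-mutated-between recurrent T = M , v≤max⁺ T (tabulate next) (inj₁ ℕ.≤-refl) , last
      where
      next : Fin n → ℕ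
      next i = proj₁ (recurrent i T)
      M : ℕ
      M = max T (tabulate next)
      last : ∀ j → j ≢ w M → LastMutatedBetween T M j
      last j j≢wM with recurrent j T | tabulate⁻ (xs≤max T (tabulate next)) j
      ... | t , T≤t , wt≡j | t≤M with ℕ.m≤n⇒m<n∨m≡n t≤M
      ...   | inj₂ refl = ⊥-elim (j≢wM (sym wt≡j))
      ...   | inj₁ t<M with last-mutation t<M wt≡j
      ...     | σ , t≤σ , σ<M , wσ≡j , untouched =
                  σ , ℕ.≤-trans T≤t t≤σ , σ<M , wσ≡j , untouched-extend untouched (j≢wM ∘ sym)

  module Ratios {k} (w : ℕ → Fin (2 ℕ.+ k)) (x₀ y₀ : Fin (2 ℕ.+ k) → ℕ)
                (x₀-pos : ∀ j → 1 ℕ.≤ x₀ j) where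
    open Orbits w

    X Y L : ℕ → Fin (2 ℕ.+ k) → ℚ
    X t j = fromℕ (iter w x₀ t j)
    Y t j = fromℕ (iter w y₀ t j)
    L = l w x₀ y₀

    X-orbit : Orbit X
    X-orbit = iter-orbit x₀

    Y-orbit : Orbit Y
    Y-orbit = iter-orbit y₀

    another : (i : Fin (2 ℕ.+ k)) → ∃ λ j → j ≢ i
    another zero    = suc zero , λ ()
    another (suc i) = zero , λ ()

    X-pos : ∀ t j → 0ℚ < X t j
    X-pos zero    j = fromℕ-pos (x₀-pos j)
    X-pos (suc t)   = orbit-pointwise X-orbit (λ _ q → 0ℚ < q)
      (<-≤-trans (X-pos t i) (≤-sumExcept (w t) (λ j → <⇒≤ (X-pos t j)) i≢wₜ)) (X-pos t)
      where
      i : Fin (2 ℕ.+ k)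
      i = proj₁ (another (w t))
      i≢wₜ : i ≢ w t
      i≢wₜ = proj₂ (another (w t))

    Y≡X*L : ∀ t j → Y t j ≡ X t j * L t j
    Y≡X*L t j = sym (fromℕ-*-ratio (iter w y₀ t j) (iter w x₀ t j) (X-pos t j))

    open Weighting X-orbit X-pos

    below : ∀ b → Weighted (λ t j → b - L t j)
    below b = weighted $ orbit-linear {α = b} {β = - 1ℚ} X-orbit Y-orbit λ t j →
      trans (expand (X t j) (L t j) b) (cong (λ y → b * X t j + - 1ℚ * y) (sym (Y≡X*L t j)))
      where
      expand : ∀ x l b → x * (b - l) ≡ b * x + - 1ℚ * (x * l)
      expand = solve-∀ ℚ-ring

    above : ∀ a → Weighted (λ t j → L t j - a)
    above a = weighted $ orbit-linear {α = 1ℚ} {β = - a} Y-orbit X-orbit λ t j →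
      trans (expand (X t j) (L t j) a) (cong (λ y → 1ℚ * y + - a * X t j) (sym (Y≡X*L t j)))
      where
      expand : ∀ x l a → x * (l - a) ≡ 1ℚ * (x * l) + - a * x
      expand = solve-∀ ℚ-ring

    hi lo width : ℕ → ℚ
    hi = lmax w x₀ y₀
    lo = lmin w x₀ y₀
    width t = hi t - lo t

    hi-antitone : ∀ {s u} → s ℕ.≤ u → hi u ≤ hi s
    hi-antitone {s} {u} s≤u with maxF-attained (L u)
    ... | J , hiᵤ≡L = subst (_≤ hi s) (sym hiᵤ≡L)
      (0≤p-q⇒q≤p (weighted-nonneg (below (hi s)) s≤u (λ j → q≤p⇒0≤p-q (maxF-ub (L s) j)) J))

    lo-monotone : ∀ {s u} → s ℕ.≤ u → lo s ≤ lo u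
    lo-monotone {s} {u} s≤u with minF-attained (L u)
    ... | I , loᵤ≡L = subst (lo s ≤_) (sym loᵤ≡L)
      (0≤p-q⇒q≤p (weighted-nonneg (above (lo s)) s≤u (λ j → q≤p⇒0≤p-q (minF-lb (L s) j)) I))

    lo≤hi : ∀ t → lo t ≤ hi t
    lo≤hi t = ≤-trans (minF-lb (L t) zero) (maxF-ub (L t) zero)

    lo∈window : ∀ {T t} → T ℕ.≤ t → lo t ∈[ lo T , hi T ]
    lo∈window {t = t} T≤t = lo-monotone T≤t , ≤-trans (lo≤hi t) (hi-antitone T≤t)

    hi∈window : ∀ {T t} → T ℕ.≤ t → hi t ∈[ lo T , hi T ]
    hi∈window {t = t} T≤t = ≤-trans (lo-monotone T≤t) (lo≤hi t) , hi-antitone T≤t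

    module _ {T M} (T≤M : T ℕ.≤ M) (mutated : ∀ j → j ≢ w M → LastMutatedBetween T M j) where

      L′ : Fin (2 ℕ.+ k) → ℚ
      L′ = L (suc M)

      upper : ∀ j → hi T - L′ (w M) ≤ (hi T - L′ j) + (hi T - L′ j)
      upper j with w M ≟ j
      ... | yes refl = p≤p+q (q≤p⇒0≤p-q (≤-trans (maxF-ub L′ j) (hi-antitone (ℕ.m≤n⇒m≤1+n T≤M))))
      ... | no wM≢j with mutated j (wM≢j ∘ sym)
      ...   | σ , T≤σ , σ<M , refl , untouched = weighted-halving (below (hi T))
                (λ i → q≤p⇒0≤p-q (≤-trans (maxF-ub (L σ) i) (hi-antitone T≤σ))) σ<M untouched

      lower : ∀ j → L′ (w M) - lo T ≤ (L′ j - lo T) + (L′ j - lo T)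
      lower j with w M ≟ j
      ... | yes refl = p≤p+q (q≤p⇒0≤p-q (≤-trans (lo-monotone (ℕ.m≤n⇒m≤1+n T≤M)) (minF-lb L′ j)))
      ... | no wM≢j with mutated j (wM≢j ∘ sym)
      ...   | σ , T≤σ , σ<M , refl , untouched = weighted-halving (above (lo T))
                (λ i → q≤p⇒0≤p-q (≤-trans (lo-monotone T≤σ) (minF-lb (L σ) i))) σ<M untouched

      width-halves : width (suc M) + width (suc M) ≤ width T
      width-halves with maxF-attained L′ | minF-attained L′
      ... | J , hi≡L′J | I , lo≡L′I = begin
        width (suc M) + width (suc M)
          ≡⟨ cong₂ (λ h l → (h - l) + (h - l)) hi≡L′J lo≡L′I ⟩
        (L′ J - L′ I) + (L′ J - L′ I)
          ≡⟨ regroup b a z (L′ J) (L′ I) ⟩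
        2w - ((b - L′ J) + (b - L′ J) + ((L′ I - a) + (L′ I - a)))
          ≤⟨ +-monoʳ-≤ 2w (neg-antimono-≤ (+-mono-≤ (upper J) (lower I))) ⟩
        2w - ((b - z) + (z - a))
          ≡⟨ cancel b a z ⟩
        width T
          ∎
        where
        open ≤-Reasoning
        b a z 2w : ℚ
        b = hi T
        a = lo T
        z = L′ (w M)
        2w = (b - a) + (b - a)
        regroup : ∀ b a z h l → (h - l) + (h - l) ≡ ((b - a) + (b - a)) - ((b - h) + (b - h) + ((l - a) + (l - a)))
        regroup = solve-∀ ℚ-ring
        cancel : ∀ b a z → ((b - a) + (b - a)) - ((b - z) + (z - a)) ≡ b - a
        cancel = solve-∀ ℚ-ring

    width-shrinks : Recurrent → ∀ K T → ∃ λ s → T ℕ.≤ s × fromℕ (2 ^ K) * width s ≤ width T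
    width-shrinks recurrent zero    T = T , ℕ.≤-refl , ≤-reflexive (*-identityˡ (width T))
    width-shrinks recurrent (suc K) T =
      let M , T≤M , mutated = all-mutated-between recurrent T
          s , M<s , shrunk  = width-shrinks recurrent K (suc M)
      in s , ℕ.≤-trans (ℕ.m≤n⇒m≤1+n T≤M) M<s , (begin
        fromℕ (2 ^ suc K) * width s                      ≡⟨ cong (_* width s) (doubling (2 ^ K)) ⟩
        (fromℕ (2 ^ K) + fromℕ (2 ^ K)) * width s        ≡⟨ *-distribʳ-+ (width s) (fromℕ (2 ^ K)) (fromℕ (2 ^ K)) ⟩
        fromℕ (2 ^ K) * width s + fromℕ (2 ^ K) * width s    ≤⟨ +-mono-≤ shrunk shrunk ⟩
        width (suc M) + width (suc M)                        ≤⟨ width-halves T≤M mutated ⟩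
        width T                                          ∎)
      where
      open ≤-Reasoning
      doubling : ∀ m → fromℕ (2 ℕ.* m) ≡ fromℕ m + fromℕ m
      doubling m = trans (cong fromℕ (cong (m ℕ.+_) (ℕ.+-identityʳ m))) (fromℕ-+ m m)

open MutationDynamics
open import Data.Nat using (ℕ; suc; _≤_; s≤s; _^_)
open import Data.Fin using (Fin)
open import Data.Product using (∃; _×_; _,_; proj₁; proj₂)
open import Relation.Binary.PropositionalEquality using (_≡_; _≢_)
open import Data.Rational using (ℚ; 0ℚ; _<_; _-_; ∣_∣; _*_)
open import Data.Rational.Properties using (≤-<-trans; *-cancelˡ-<-nonNeg; module ≤-Reasoning)

proposition3p6 :
  (n : ℕ) → 3 ≤ n →
  (w : ℕ → Fin n) →
  (∀ t → w (suc t) ≢ w t) →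
  (∀ (i : Fin n) (t : ℕ) → ∃ λ s → t ≤ s × w s ≡ i) →
  (x₀ y₀ : Fin n → ℕ) →
  (∀ j → 1 ≤ x₀ j) →
  (ε : ℚ) → 0ℚ < ε →
  ∃ λ T → ∀ s t → T ≤ s → T ≤ t →
    (∣ lmin w x₀ y₀ s - lmin w x₀ y₀ t ∣ < ε)
    × (∣ lmax w x₀ y₀ s - lmax w x₀ y₀ t ∣ < ε)
    × (∣ lmax w x₀ y₀ t - lmin w x₀ y₀ t ∣ < ε)
proposition3p6 (suc (suc (suc n))) (s≤s (s≤s (s≤s _))) w _ recurrent x₀ y₀ x₀-pos ε 0<ε =
  T , λ s t T≤s T≤t → close (lo∈window T≤s) (lo∈window T≤t)
                    , close (hi∈window T≤s) (hi∈window T≤t)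
                    , close (hi∈window T≤t) (lo∈window T≤t)
  where
  open Ratios w x₀ y₀ x₀-pos
  K : ℕ
  K = proj₁ (2^-archimedean (width 0) ε 0<ε)
  T : ℕ
  T = proj₁ (width-shrinks recurrent K 0)
  width<ε : width T < ε
  width<ε = *-cancelˡ-<-nonNeg (fromℕ (2 ^ K)) (begin-strict
    fromℕ (2 ^ K) * width T  ≤⟨ proj₂ (proj₂ (width-shrinks recurrent K 0)) ⟩
    width 0                  <⟨ proj₂ (2^-archimedean (width 0) ε 0<ε) ⟩
    fromℕ (2 ^ K) * ε        ∎)
    where open ≤-Reasoning
  close : ∀ {p q} → p ∈[ lo T , hi T ] → q ∈[ lo T , hi T ] → ∣ p - q ∣ < ε
  close p∈ q∈ = ≤-<-trans (∣p-q∣≤b-a p∈ q∈) width<ε
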